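{- Let $n\ge 3$ and let $\overrightarrow{C_n}$ be an oriented cycle. Then $\overrightarrow{C_n}$ is $\{1\}$-antimagic if and only if it is unidirectional or $\Theta$-oriented.
   Context: An oriented cycle $\overrightarrow{C_n}$ is an orientation of the cycle on vertices $v_1,\dots,v_n$. For vertices $u,y$, $d(u,y)$ is the length of a shortest directed path from $u$ to $y$ ($d(u,u)=0$; $d(u,y)=\infty$ if no such path). For a nonempty set $D$ of finite distances occurring in the oriented graph, the $D$-neighborhood of $v$ is $N_D(v)=\{y : d(v,y)\in D\}$. A bijection $f:V\to\{1,\dots,|V|\}$ is a $D$-antimagic labeling if the $D$-weights $\omega_D(v)=\sum_{y\in N_D(v)} f(y)$ are pairwise distinct; the graph is $D$-antimagic if such a labeling exists. The cycle is unidirectional if its arc set is $\{(v_i,v_{i+1}):1\le i\le n-1\}\cup\{(v_n,v_1)\}$ (for a suitable labeling of the vertices). It is $\Theta$-oriented if it has exactly one source and exactly one sink and they are adjacent, i.e. (for a suitable labeling) its arc set is $\{(v_i,v_{i+1}):1\le i\le n-1\}\cup\{(v_1,v_n)\}$. A source has in-degree $0$, a sink has out-degree $0$. -}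

module Defs where

open import Data.Nat as ℕ using (ℕ; zero; suc; _+_; s≤s)
open import Data.Nat.Properties using (_<?_)
open import Data.Fin using (Fin; zero; suc; toℕ; fromℕ<; _≟_)
open import Data.Fin.Properties using ()
open import Data.Bool using (Bool; true; false; if_then_else_; _∨_; _∧_; not)
open import Data.List using (map; allFin)
open import Data.Nat.ListAction using (sum)
open import Data.Product using (Σ; ∃; _×_; _,_)
open import Data.Sum using (_⊎_)
open import Relation.Nullary using (¬_; yes; no; Dec)
open import Relation.Nullary.Decidable using (⌊_⌋)
open import Relation.Binary.PropositionalEquality using (_≡_)
open import Function.Definitions using (Bijective)
open import Function.Bundles using (_⇔_)

next : ∀ {n} → Fin n → Fin n
next {suc m} i with suc (toℕ i) <? suc m
... | yes p = fromℕ< p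
... | no _  = zero

-- An oriented cycle on the vertices v_0, …, v_{n-1} (underlying cycle with
-- edges {v_i , v_{i+1 mod n}}) is given by a choice, for every edge i,
-- of its direction: o i ≡ true means the arc (v_i , v_{i+1}),
-- o i ≡ false means the arc (v_{i+1} , v_i).
Orientation : ℕ → Set
Orientation n = Fin n → Bool

arc? : ∀ {n} → Orientation n → Fin n → Fin n → Bool
arc? o u v = (⌊ next u ≟ v ⌋ ∧ o u) ∨ (⌊ next v ≟ u ⌋ ∧ not (o v))

Arc : ∀ {n} → Orientation n → Fin n → Fin n → Set
Arc o u v = arc? o u v ≡ true

-- N_{1}(v) = { y : d(v,y) = 1 } = out-neighbours of v (there are no loops).
-- {1}-weight of v under labeling f (label of y is 1 + toℕ (f y) ∈ {1..n}).
weight1 : ∀ {n} → Orientation n → (Fin n → Fin n) → Fin n → ℕ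
weight1 {n} o f v =
  sum (map (λ y → if arc? o v y then suc (toℕ (f y)) else 0) (allFin n))

Antimagic1Labeling : ∀ {n} → Orientation n → (Fin n → Fin n) → Set
Antimagic1Labeling {n} o f =
  Bijective {A = Fin n} _≡_ _≡_ f
  × (∀ u v → weight1 o f u ≡ weight1 o f v → u ≡ v)

IsAntimagic1 : ∀ {n} → Orientation n → Set
IsAntimagic1 o = ∃ λ f → Antimagic1Labeling o f

ArcStd : ∀ {n} → Fin n → Fin n → Set
ArcStd u v = next u ≡ v

Unidirectional : ∀ {n} → Orientation n → Set
Unidirectional {n} o =
  Σ (Fin n → Fin n) λ σ →
    Bijective {A = Fin n} _≡_ _≡_ σ × (∀ u v → Arc o u v ⇔ ArcStd (σ u) (σ v))

IsSource : ∀ {n} → Orientation n → Fin n → Set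
IsSource o v = ∀ u → ¬ Arc o u v

IsSink : ∀ {n} → Orientation n → Fin n → Set
IsSink o v = ∀ u → ¬ Arc o v u

ThetaOriented : ∀ {n} → Orientation n → Set
ThetaOriented o =
  Σ _ λ s → Σ _ λ t →
    IsSource o s × (∀ s' → IsSource o s' → s' ≡ s) ×
    IsSink o t × (∀ t' → IsSink o t' → t' ≡ t) ×
    (Arc o s t ⊎ Arc o t s)

module Submission where

-- The {1}-weight of v is the sum of the labels of its out-neighbours: 0 for a sink, two labels
-- for a source, and a single label for every other vertex. Since all sinks have weight 0, an
-- antimagic cycle has at most one sink. Reading the directions of the edges around the cycle as a
-- Boolean sequence, sinks are its descents and sources its ascents, and a cyclic sequence has as
-- many of each. So either there is no sink and no source, and the cycle is unidirectional, or
-- there is exactly one of each; they are adjacent, since otherwise both neighbours of the sink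
-- would have it as their only out-neighbour and hence equal weights.
-- Conversely, every vertex of a unidirectional cycle has a single out-neighbour, and these are
-- pairwise distinct, so any labeling is antimagic. In a Θ-oriented cycle, give the sink the
-- largest label n: then the sink has weight 0, the source weight > n, and the other vertices
-- weights in [1, n] that are again labels of pairwise distinct out-neighbours.

open import Defs
open import Algebra.Properties.CommutativeMonoid.Sum as Sum using ()
open import Data.Bool using (Bool; true; false; not; _∧_; if_then_else_)
import Data.Bool.Properties as Bool
open import Data.Empty using (⊥-elim)
open import Data.Fin using (Fin; zero; suc; toℕ; fromℕ; inject₁; opposite; punchOut; _≟_)
open import Data.Fin.Induction using (<-weakInduction)
open import Data.Fin.Properties
  using (toℕ-injective; toℕ-inject₁; toℕ-fromℕ; toℕ-fromℕ<; toℕ<n; inject₁ℕ<; 0≢1+n;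
         punchInᵢ≢i; punchIn-punchOut; punchIn-injective; any?)
  renaming (suc-injective to Fin-suc-injective)
open import Data.Fin.Relation.Unary.Top using (view; ‵fromℕ; ‵inj₁)
open import Data.List using (map; allFin; tabulate)
open import Data.List.Properties using (map-tabulate)
import Data.Nat.ListAction as List
open import Data.Nat using (ℕ; zero; suc; _+_; _≤_; _<_; s≤s; z≤n)
open import Data.Nat.Properties
  using (+-0-commutativeMonoid; suc-injective; +-identityʳ; +-comm; +-cancelʳ-≡; +-monoʳ-≤;
         m≤m+n; m<m+n; m<n+m; <-irrefl; ≤-<-trans; n≮n; m+1+n≢n; _<?_)
open import Data.Product using (_×_; _,_; ∃; proj₁; proj₂)
open import Data.Sum using (_⊎_; inj₁; inj₂; [_,_]′)
open import Data.Vec.Functional using (removeAt)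
open import Function using (_∘_; id)
open import Function.Bundles using (_⇔_; mk⇔; Equivalence; Bijection)
open import Function.Definitions using (Injective; Bijective)
import Function.Construct.Identity as Identity
open import Function.Properties.Inverse using (Inverse⇒Bijection)
import Data.Fin.Permutation as Perm
import Data.Fin.Permutation.Components as PC
open import Relation.Binary.PropositionalEquality
open import Relation.Nullary using (¬_; Dec; yes; no; does; contradiction)
open import Relation.Nullary.Decidable using (⌊_⌋; isYes≗does; dec-true; dec-false; _×-dec_)

open Equivalence using (to; from)
open Sum +-0-commutativeMonoid
  using (sum; sum-remove; sum-cong-≗; sum-replicate-zero; sum-init-last; ∑-distrib-+)

module _ {m : ℕ} where

  prev : Fin (suc m) → Fin (suc m)
  prev zero    = fromℕ m
  prev (suc i) = inject₁ i

  next-inject₁ : (i : Fin m) → next (inject₁ i) ≡ suc i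
  next-inject₁ i with suc (toℕ (inject₁ i)) <? suc m
  ... | yes p = toℕ-injective (trans (toℕ-fromℕ< p) (cong suc (toℕ-inject₁ i)))
  ... | no ¬p = contradiction (s≤s (inject₁ℕ< i)) ¬p

  next-fromℕ : next (fromℕ m) ≡ zero
  next-fromℕ with suc (toℕ (fromℕ m)) <? suc m
  ... | yes p = contradiction (subst (λ x → suc x < suc m) (toℕ-fromℕ m) p) (n≮n (suc m))
  ... | no _  = refl

  next-prev : ∀ v → next (prev v) ≡ v
  next-prev zero    = next-fromℕ
  next-prev (suc i) = next-inject₁ i

  prev-next : ∀ v → prev (next v) ≡ v
  prev-next v with view v
  ... | ‵fromℕ          = cong prev next-fromℕ
  ... | ‵inj₁ {i = i} _ = cong prev (next-inject₁ i)

  next-injective : ∀ {u v} → next u ≡ next v → u ≡ v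
  next-injective {u} {v} e = trans (sym (prev-next u)) (trans (cong prev e) (prev-next v))

  prev-injective : ∀ {u v} → prev u ≡ prev v → u ≡ v
  prev-injective {u} {v} e = trans (sym (next-prev u)) (trans (cong next e) (next-prev v))

  next-induction : (P : Fin (suc m) → Set) → P zero → (∀ v → P v → P (next v)) → ∀ v → P v
  next-induction P P₀ step = <-weakInduction P P₀ λ i → subst P (next-inject₁ i) ∘ step (inject₁ i)

opposite-fromℕ : ∀ m → opposite (fromℕ m) ≡ zero
opposite-fromℕ zero    = refl
opposite-fromℕ (suc m) = cong inject₁ (opposite-fromℕ m)

opposite-inject₁ : ∀ {m} (i : Fin m) → opposite (inject₁ i) ≡ suc (opposite i)
opposite-inject₁ zero    = refl
opposite-inject₁ (suc i) = cong inject₁ (opposite-inject₁ i)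

next-opposite : ∀ {m} (v : Fin (suc m)) → next (opposite v) ≡ opposite (prev v)
next-opposite {m} zero = trans next-fromℕ (sym (opposite-fromℕ m))
next-opposite (suc i)  = trans (next-inject₁ (opposite i)) (sym (opposite-inject₁ i))

next≢prev : ∀ {k} (v : Fin (3 + k)) → next v ≢ prev v
next≢prev v with view v
... | ‵fromℕ              = 0≢1+n ∘ trans (sym next-fromℕ)
... | ‵inj₁ {i = zero} _  = 0≢1+n ∘ Fin-suc-injective ∘ trans (sym (next-inject₁ zero))
... | ‵inj₁ {i = suc j} _ = λ e → m+1+n≢n 1 (begin
  2 + toℕ j                  ≡⟨ cong toℕ (trans (sym (next-inject₁ (suc j))) e) ⟩
  toℕ (inject₁ (inject₁ j))  ≡⟨ toℕ-inject₁ (inject₁ j) ⟩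
  toℕ (inject₁ j)            ≡⟨ toℕ-inject₁ j ⟩
  toℕ j                      ∎)
  where open ≡-Reasoning

sum-tabulate : ∀ {n} (t : Fin n → ℕ) → List.sum (tabulate t) ≡ sum t
sum-tabulate {zero}  t = refl
sum-tabulate {suc n} t = cong (t zero +_) (sum-tabulate (t ∘ suc))

sum-allFin : ∀ {n} (t : Fin n → ℕ) → List.sum (map t (allFin n)) ≡ sum t
sum-allFin t = trans (cong List.sum (map-tabulate id t)) (sum-tabulate t)

sum-≡0 : ∀ {n} {t : Fin n → ℕ} → (∀ i → t i ≡ 0) → sum t ≡ 0
sum-≡0 {n} t≡0 = trans (sum-cong-≗ t≡0) (sum-replicate-zero n)

≤-sum : ∀ {n} (t : Fin n → ℕ) i → t i ≤ sum t
≤-sum {suc n} t i = subst (t i ≤_) (sym (sum-remove {i = i} t)) (m≤m+n (t i) _)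

sum-single : ∀ {n} {t : Fin n → ℕ} i → (∀ j → j ≢ i → t j ≡ 0) → sum t ≡ t i
sum-single {suc n} {t} i t≡0 = begin
  sum t                     ≡⟨ sum-remove {i = i} t ⟩
  t i + sum (removeAt t i)  ≡⟨ cong (t i +_) (sum-≡0 (λ j → t≡0 _ (punchInᵢ≢i i j))) ⟩
  t i + 0                   ≡⟨ +-identityʳ (t i) ⟩
  t i                       ∎
  where open ≡-Reasoning

removeAt-punchOut : ∀ {n} (t : Fin (suc n) → ℕ) {i j} (i≢j : i ≢ j) → removeAt t i (punchOut i≢j) ≡ t j
removeAt-punchOut t i≢j = cong t (punchIn-punchOut i≢j)

+-≤-sum : ∀ {n} (t : Fin n → ℕ) {i j} → i ≢ j → t i + t j ≤ sum t
+-≤-sum {suc n} t {i} i≢j = subst₂ _≤_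
  (cong (t i +_) (removeAt-punchOut t i≢j)) (sym (sum-remove {i = i} t))
  (+-monoʳ-≤ (t i) (≤-sum (removeAt t i) (punchOut i≢j)))

sum-pair : ∀ {n} {t : Fin n → ℕ} {i j} → i ≢ j → (∀ k → k ≢ i → k ≢ j → t k ≡ 0) → sum t ≡ t i + t j
sum-pair {suc n} {t} {i} {j} i≢j t≡0 = begin
  sum t                                  ≡⟨ sum-remove {i = i} t ⟩
  t i + sum (removeAt t i)               ≡⟨ cong (t i +_) (sum-single (punchOut i≢j) rest≡0) ⟩
  t i + removeAt t i (punchOut i≢j)      ≡⟨ cong (t i +_) (removeAt-punchOut t i≢j) ⟩
  t i + t j                              ∎
  where
  open ≡-Reasoning
  rest≡0 : ∀ k → k ≢ punchOut i≢j → removeAt t i k ≡ 0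
  rest≡0 k k≢ = t≡0 _ (punchInᵢ≢i i k)
    λ e → k≢ (punchIn-injective i k _ (trans e (sym (punchIn-punchOut i≢j))))

sum-next : ∀ {m} (t : Fin (suc m) → ℕ) → sum (t ∘ next) ≡ sum t
sum-next {m} t = begin
  sum (t ∘ next)                               ≡⟨ sum-init-last (t ∘ next) ⟩
  sum (t ∘ next ∘ inject₁) + t (next (fromℕ m))
    ≡⟨ cong₂ _+_ (sum-cong-≗ (cong t ∘ next-inject₁)) (cong t next-fromℕ) ⟩
  sum (t ∘ suc) + t zero                       ≡⟨ +-comm _ (t zero) ⟩
  sum t                                        ∎
  where open ≡-Reasoning

indicator : Bool → ℕ
indicator b = if b then 1 else 0

module _ {n : ℕ} {P : Fin n → Set} (P? : ∀ i → Dec (P i)) where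

  count : ℕ
  count = sum λ i → indicator (does (P? i))

  private
    indicator-yes : ∀ {i} → P i → indicator (does (P? i)) ≡ 1
    indicator-yes {i} p = cong indicator (dec-true (P? i) p)

    indicator-no : ∀ {i} → ¬ P i → indicator (does (P? i)) ≡ 0
    indicator-no {i} ¬p = cong indicator (dec-false (P? i) ¬p)

  count≡0 : (∀ i → ¬ P i) → count ≡ 0
  count≡0 ¬P = sum-≡0 (λ i → indicator-no (¬P i))

  count≡1 : ∀ {i} → P i → (∀ j → P j → j ≡ i) → count ≡ 1
  count≡1 {i} p unique =
    trans (sum-single i λ j j≢i → indicator-no (j≢i ∘ unique j)) (indicator-yes p)

  count≡0⇒¬ : count ≡ 0 → ∀ i → ¬ P i
  count≡0⇒¬ c≡0 i p with () ← subst₂ _≤_ (indicator-yes p) c≡0 (≤-sum _ i)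

  count≡1⇒unique : count ≡ 1 → ∀ {i j} → P i → P j → i ≡ j
  count≡1⇒unique c≡1 {i} {j} p q with i ≟ j
  ... | yes i≡j = i≡j
  ... | no i≢j with s≤s () ←
    subst₂ _≤_ (cong₂ _+_ (indicator-yes p) (indicator-yes q)) c≡1 (+-≤-sum _ i≢j)

-- For an orientation b, the two edges at v are directed by b (prev v) and b v, so that sinks are
-- the descents and sources the ascents of b.
module _ {m : ℕ} (b : Fin (suc m) → Bool) where

  Descent Ascent Flat : Fin (suc m) → Set
  Descent v = b (prev v) ≡ true  × b v ≡ false
  Ascent  v = b (prev v) ≡ false × b v ≡ true
  Flat    v = b (prev v) ≡ b v

  descent? : ∀ v → Dec (Descent v)
  descent? v = (b (prev v) Bool.≟ true) ×-dec (b v Bool.≟ false)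

  ascent? : ∀ v → Dec (Ascent v)
  ascent? v = (b (prev v) Bool.≟ false) ×-dec (b v Bool.≟ true)

  descent⊎ascent⊎flat : ∀ v → Descent v ⊎ Ascent v ⊎ Flat v
  descent⊎ascent⊎flat v with b (prev v) | b v
  ... | true  | false = inj₁ (refl , refl)
  ... | false | true  = inj₂ (inj₁ (refl , refl))
  ... | true  | true  = inj₂ (inj₂ refl)
  ... | false | false = inj₂ (inj₂ refl)

  ascent⇒¬flat : ∀ {v} → Ascent v → ¬ Flat v
  ascent⇒¬flat (p , q) flat with () ← trans (sym p) (trans flat q)

  descent⇒¬flat : ∀ {v} → Descent v → ¬ Flat v
  descent⇒¬flat (p , q) flat with () ← trans (sym q) (trans (sym flat) p)

  -- Both counts are the number of vertices v with b v, minus those with b (prev v) ∧ b v.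
  descents≡ascents : count descent? ≡ count ascent?
  descents≡ascents = +-cancelʳ-≡ _ _ _ (begin
    count descent? + sum both          ≡⟨ split-at-prev ⟨
    sum (indicator ∘ b ∘ prev)         ≡⟨ sum-next (indicator ∘ b ∘ prev) ⟨
    sum (indicator ∘ b ∘ prev ∘ next)  ≡⟨ sum-cong-≗ (cong (indicator ∘ b) ∘ prev-next) ⟩
    sum (indicator ∘ b)                ≡⟨ split-at-self ⟩
    count ascent? + sum both           ∎)
    where
    open ≡-Reasoning
    both : Fin (suc m) → ℕ
    both v = indicator (b (prev v) ∧ b v)
    split-descent : ∀ x y →
      indicator x ≡ indicator (does ((x Bool.≟ true) ×-dec (y Bool.≟ false))) + indicator (x ∧ y)
    split-descent true  true  = refl
    split-descent true  false = refl
    split-descent false _     = refl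
    split-ascent : ∀ x y →
      indicator y ≡ indicator (does ((x Bool.≟ false) ×-dec (y Bool.≟ true))) + indicator (x ∧ y)
    split-ascent true  true  = refl
    split-ascent false true  = refl
    split-ascent true  false = refl
    split-ascent false false = refl
    split-at-prev : sum (indicator ∘ b ∘ prev) ≡ count descent? + sum both
    split-at-prev = trans (sum-cong-≗ (λ v → split-descent (b (prev v)) (b v)))
      (∑-distrib-+ (λ v → indicator (does (descent? v))) both)
    split-at-self : sum (indicator ∘ b) ≡ count ascent? + sum both
    split-at-self = trans (sum-cong-≗ (λ v → split-ascent (b (prev v)) (b v)))
      (∑-distrib-+ (λ v → indicator (does (ascent? v))) both)

  no-descent⇒flat : (∀ v → ¬ Descent v) → ∀ v → Flat v
  no-descent⇒flat no-descent v with descent⊎ascent⊎flat v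
  ... | inj₁ descent       = ⊥-elim (no-descent v descent)
  ... | inj₂ (inj₁ ascent) = ⊥-elim (count≡0⇒¬ ascent? no-ascents v ascent)
    where
    no-ascents : count ascent? ≡ 0
    no-ascents = trans (sym descents≡ascents) (count≡0 descent? no-descent)
  ... | inj₂ (inj₂ flat)   = flat

  flat⇒constant : (∀ v → Flat v) → ∀ v → b v ≡ b zero
  flat⇒constant flat = next-induction (λ v → b v ≡ b zero) refl
    λ v bv≡b₀ → trans (sym (trans (cong b (sym (prev-next v))) (flat (next v)))) bv≡b₀

outNeighbour : ∀ {m} → Orientation (suc m) → Fin (suc m) → Fin (suc m)
outNeighbour o v = if o v then next v else prev v

FlankedSink : ∀ {m} → Orientation (suc m) → Fin (suc m) → Set
FlankedSink o y = Descent o y × Flat o (prev y) × Flat o (next y)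

⌊⌋-true : ∀ {A : Set} (a? : Dec A) → A → ⌊ a? ⌋ ≡ true
⌊⌋-true a? a = trans (isYes≗does a?) (dec-true a? a)

⌊⌋-false : ∀ {A : Set} (a? : Dec A) → ¬ A → ⌊ a? ⌋ ≡ false
⌊⌋-false a? ¬a = trans (isYes≗does a?) (dec-false a? ¬a)

module _ {m : ℕ} (o : Orientation (suc m)) where

  data ArcView (u : Fin (suc m)) : Fin (suc m) → Set where
    forward  : o u ≡ true         → ArcView u (next u)
    backward : o (prev u) ≡ false → ArcView u (prev u)

  arcView : ∀ {u v} → Arc o u v → ArcView u v
  arcView {u} {v} a with next u ≟ v | o u in ou | next v ≟ u | o v in ov
  ... | yes refl | true  | _        | _     = forward ou
  ... | _        | _     | yes e    | false = backward-to (trans (cong prev (sym e)) (prev-next v)) ov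
    where
    backward-to : ∀ {w} → prev u ≡ w → o w ≡ false → ArcView u w
    backward-to refl = backward
  ... | yes _    | false | yes _    | true  = contradiction a λ ()
  ... | yes _    | false | no _     | _     = contradiction a λ ()
  ... | no _     | _     | yes _    | true  = contradiction a λ ()
  ... | no _     | _     | no _     | _     = contradiction a λ ()

  arc-forward : ∀ {u} → o u ≡ true → Arc o u (next u)
  arc-forward {u} ou rewrite ⌊⌋-true (next u ≟ next u) refl | ou = refl

  arc-backward : ∀ {u} → o (prev u) ≡ false → Arc o u (prev u)
  arc-backward {u} ou rewrite ⌊⌋-true (next (prev u) ≟ u) (next-prev u) | ou = Bool.∨-zeroʳ _

  sink⇔descent : ∀ {v} → IsSink o v ⇔ Descent o v
  sink⇔descent =
    mk⇔ (λ sink → Bool.¬-not (sink _ ∘ arc-backward) , Bool.¬-not (sink _ ∘ arc-forward)) descent⇒sink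
    where
    descent⇒sink : ∀ {v} → Descent o v → IsSink o v
    descent⇒sink (p , q) u a with arcView a
    ... | forward ou  = contradiction (trans (sym q) ou) λ ()
    ... | backward op = contradiction (trans (sym p) op) λ ()

  source⇔ascent : ∀ {v} → IsSource o v ⇔ Ascent o v
  source⇔ascent {v} = mk⇔ source⇒ascent ascent⇒source
    where
    source⇒ascent : IsSource o v → Ascent o v
    source⇒ascent source =
        Bool.¬-not (source (prev v) ∘ subst (Arc o (prev v)) (next-prev v) ∘ arc-forward)
      , Bool.¬-not (source (next v) ∘ subst (Arc o (next v)) (prev-next v)
                                    ∘ arc-backward ∘ trans (cong o (prev-next v)))
    ascent⇒source : ∀ {v} → Ascent o v → IsSource o v
    ascent⇒source (p , q) u a with arcView a
    ... | forward ou  = contradiction (trans (sym p) (trans (cong o (prev-next u)) ou)) λ ()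
    ... | backward op = contradiction (trans (sym q) op) λ ()

  sink-between : ∀ {u w} → o (prev u) ≡ true → o u ≡ true → o (prev w) ≡ false → o w ≡ false →
                 next u ≡ prev w → ∃ (FlankedSink o)
  sink-between {u} {w} pu ou pw ow e =
    next u , (trans (cong o (prev-next u)) ou , trans (cong o e) pw) ,
    subst (Flat o) (sym (prev-next u)) (trans pu (sym ou)) ,
    subst (Flat o) (sym (trans (cong next e) (next-prev w))) (trans pw (sym ow))

  flat-collision : ∀ {u v} → Flat o u → Flat o v → u ≢ v →
                   outNeighbour o u ≡ outNeighbour o v → ∃ (FlankedSink o)
  flat-collision {u} {v} fu fv u≢v e with o u in ou | o v in ov
  ... | true  | true  = contradiction (next-injective e) u≢v
  ... | false | false = contradiction (prev-injective e) u≢v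
  ... | true  | false = sink-between fu ou fv ov e
  ... | false | true  = sink-between fv ov fu ou (sym e)

label : ∀ {n} → (Fin n → Fin n) → Fin n → ℕ
label f y = suc (toℕ (f y))

-- For n ≤ 2 the two neighbours next v and prev v coincide and the weight formula fails.
module _ {k : ℕ} (o : Orientation (3 + k)) where

  arc?-next : ∀ v → arc? o v (next v) ≡ o v
  arc?-next v
    rewrite ⌊⌋-true (next v ≟ next v) refl
          | ⌊⌋-false (next (next v) ≟ v) (next≢prev v ∘ trans (sym (prev-next (next v))) ∘ cong prev)
    = Bool.∨-identityʳ (o v)

  arc?-prev : ∀ v → arc? o v (prev v) ≡ not (o (prev v))
  arc?-prev v
    rewrite ⌊⌋-false (next v ≟ prev v) (next≢prev v)
          | ⌊⌋-true (next (prev v) ≟ v) (next-prev v)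
    = refl

  arc?-elsewhere : ∀ {v w} → w ≢ next v → w ≢ prev v → arc? o v w ≡ false
  arc?-elsewhere {v} {w} w≢next w≢prev with arc? o v w in a
  ... | false = refl
  ... | true with arcView o {v} {w} a
  ...   | forward _  = contradiction refl w≢next
  ...   | backward _ = contradiction refl w≢prev

  module _ (f : Fin (3 + k) → Fin (3 + k)) where

    weight-formula : ∀ v → weight1 o f v ≡
      (if o v then label f (next v) else 0) + (if not (o (prev v)) then label f (prev v) else 0)
    weight-formula v = begin
      weight1 o f v                        ≡⟨ sum-allFin (λ w → term (arc? o v w) w) ⟩
      sum (λ w → term (arc? o v w) w)
        ≡⟨ sum-pair (next≢prev v) (λ w p q → cong (λ b → term b w) (arc?-elsewhere {v = v} p q)) ⟩
      term (arc? o v (next v)) (next v) + term (arc? o v (prev v)) (prev v)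
        ≡⟨ cong₂ _+_ (cong (λ b → term b (next v)) (arc?-next v))
                     (cong (λ b → term b (prev v)) (arc?-prev v)) ⟩
      term (o v) (next v) + term (not (o (prev v))) (prev v) ∎
      where
      open ≡-Reasoning
      term : Bool → Fin (3 + k) → ℕ
      term b w = if b then label f w else 0

    weight-descent : ∀ {v} → Descent o v → weight1 o f v ≡ 0
    weight-descent {v} (p , q) rewrite weight-formula v | p | q = refl

    weight-ascent : ∀ {v} → Ascent o v → weight1 o f v ≡ label f (next v) + label f (prev v)
    weight-ascent {v} (p , q) rewrite weight-formula v | p | q = refl

    weight-flat : ∀ {v} → Flat o v → weight1 o f v ≡ label f (outNeighbour o v)
    weight-flat {v} flat rewrite weight-formula v | flat = choose (o v)
      where
      choose : ∀ b → (if b then label f (next v) else 0) + (if not b then label f (prev v) else 0)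
                     ≡ label f (if b then next v else prev v)
      choose true  = +-identityʳ _
      choose false = refl

    flat-weight-injective : Injective _≡_ _≡_ f → (∀ y → ¬ FlankedSink o y) →
                            ∀ {u v} → Flat o u → Flat o v → weight1 o f u ≡ weight1 o f v → u ≡ v
    flat-weight-injective f-injective unflanked {u} {v} fu fv e with u ≟ v
    ... | yes u≡v = u≡v
    ... | no u≢v  = contradiction sink (unflanked _)
      where
      same-label : label f (outNeighbour o u) ≡ label f (outNeighbour o v)
      same-label = trans (sym (weight-flat fu)) (trans e (weight-flat fv))
      sink : FlankedSink o _
      sink = proj₂ (flat-collision o fu fv u≢v (f-injective (toℕ-injective (suc-injective same-label))))

module _ {m : ℕ} {o : Orientation (suc m)} where

  unidirectional⇒flat : Unidirectional o → ∀ v → Flat o v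
  unidirectional⇒flat (σ , (_ , σ-surjective) , arc⇔) v
    with descent⊎ascent⊎flat o v | σ-surjective (next (σ v)) | σ-surjective (prev (σ v))
  ... | inj₁ descent       | w , σw≡ | _ =
    ⊥-elim (from (sink⇔descent o) descent w (from (arc⇔ v w) (sym (σw≡ refl))))
  ... | inj₂ (inj₁ ascent) | _ | w , σw≡ =
    ⊥-elim (from (source⇔ascent o) ascent w
                 (from (arc⇔ w v) (trans (cong next (σw≡ refl)) (next-prev (σ v)))))
  ... | inj₂ (inj₂ flat)   | _ | _ = flat

  constant-true⇒unidirectional : (∀ v → o v ≡ true) → Unidirectional o
  constant-true⇒unidirectional all-true =
    id , Identity.bijective _≡_ ,
    λ u v → mk⇔ arc⇒next (λ e → subst (Arc o u) e (arc-forward o (all-true u)))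
    where
    arc⇒next : ∀ {u v} → Arc o u v → next u ≡ v
    arc⇒next a with arcView o a
    ... | forward _  = refl
    ... | backward p = contradiction (trans (sym p) (all-true _)) λ ()

  constant-false⇒unidirectional : (∀ v → o v ≡ false) → Unidirectional o
  constant-false⇒unidirectional all-false =
    opposite , opposite-bijective , λ u v → mk⇔ arc⇒next-opposite (opposite-next⇒arc u v)
    where
    opposite-bijective = Bijection.bijective (Inverse⇒Bijection Perm.reverse)
    arc⇒next-opposite : ∀ {u v} → Arc o u v → next (opposite u) ≡ opposite v
    arc⇒next-opposite {u} a with arcView o a
    ... | forward p  = contradiction (trans (sym p) (all-false u)) λ ()
    ... | backward _ = next-opposite u
    opposite-next⇒arc : ∀ u v → next (opposite u) ≡ opposite v → Arc o u v
    opposite-next⇒arc u v e =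
      subst (Arc o u) (proj₁ opposite-bijective (trans (sym (next-opposite u)) e))
                      (arc-backward o (all-false (prev u)))

  flat⇒unidirectional : (∀ v → Flat o v) → Unidirectional o
  flat⇒unidirectional flat with o zero in o₀
  ... | true  = constant-true⇒unidirectional  (λ v → trans (flat⇒constant o flat v) o₀)
  ... | false = constant-false⇒unidirectional (λ v → trans (flat⇒constant o flat v) o₀)

module _ {k : ℕ} {o : Orientation (3 + k)} where

  unidirectional⇒antimagic : Unidirectional o → IsAntimagic1 o
  unidirectional⇒antimagic uni =
    id , Identity.bijective _≡_ , λ u v → flat-weight-injective o id id unflanked (flat u) (flat v)
    where
    flat = unidirectional⇒flat uni
    unflanked : ∀ y → ¬ FlankedSink o y
    unflanked y (descent , _) = descent⇒¬flat o descent (flat y)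

  module ThetaLabeling {s t : Fin (3 + k)} (s-ascent : Ascent o s) (t-descent : Descent o t)
    (t-next-to-s : t ≡ next s ⊎ t ≡ prev s) (classify : ∀ v → v ≡ t ⊎ v ≡ s ⊎ Flat o v) where

    f : Fin (3 + k) → Fin (3 + k)
    f = PC.transpose t (fromℕ (2 + k))

    f-bijective : Bijective _≡_ _≡_ f
    f-bijective = Bijection.bijective (Inverse⇒Bijection (Perm.transpose t (fromℕ (2 + k))))

    weight : Fin (3 + k) → ℕ
    weight = weight1 o f

    label-t : label f t ≡ 3 + k
    label-t rewrite dec-true (t ≟ t) refl = cong suc (toℕ-fromℕ (2 + k))

    weight-t : weight t ≡ 0
    weight-t = weight-descent o f t-descent

    weight-s : 3 + k < weight s
    weight-s = subst (3 + k <_) (sym (weight-ascent o f s-ascent)) (neighbour-labels t-next-to-s)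
      where
      neighbour-labels : t ≡ next s ⊎ t ≡ prev s → 3 + k < label f (next s) + label f (prev s)
      neighbour-labels (inj₁ refl) =
        subst (λ x → 3 + k < x + label f (prev s)) (sym label-t) (m<m+n (3 + k) (s≤s z≤n))
      neighbour-labels (inj₂ refl) =
        subst (λ x → 3 + k < label f (next s) + x) (sym label-t) (m<n+m (3 + k) (s≤s z≤n))

    weight-flat-≤ : ∀ {v} → Flat o v → weight v ≤ 3 + k
    weight-flat-≤ flat = subst (_≤ 3 + k) (sym (weight-flat o f flat)) (toℕ<n (f (outNeighbour o _)))

    weight≡0⇒t : ∀ {v} → weight v ≡ 0 → v ≡ t
    weight≡0⇒t {v} w≡0 with classify v
    ... | inj₁ v≡t        = v≡t
    ... | inj₂ (inj₁ refl) with () ← subst (3 + k <_) w≡0 weight-s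
    ... | inj₂ (inj₂ flat) with () ← trans (sym (weight-flat o f flat)) w≡0

    large-weight⇒s : ∀ {v} → 3 + k < weight v → v ≡ s
    large-weight⇒s {v} large with classify v
    ... | inj₁ refl        with () ← subst (3 + k <_) weight-t large
    ... | inj₂ (inj₁ v≡s)  = v≡s
    ... | inj₂ (inj₂ flat) = contradiction (≤-<-trans (weight-flat-≤ flat) large) (<-irrefl refl)

    unflanked : ∀ y → ¬ FlankedSink o y
    unflanked y (descent , flanks) with weight≡0⇒t {y} (weight-descent o f descent)
    ... | refl = s-unflat t-next-to-s flanks
      where
      s-unflat : t ≡ next s ⊎ t ≡ prev s → ¬ (Flat o (prev t) × Flat o (next t))
      s-unflat (inj₁ refl) (flat-prev , _) =
        ascent⇒¬flat o s-ascent (subst (Flat o) (prev-next s) flat-prev)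
      s-unflat (inj₂ refl) (_ , flat-next) =
        ascent⇒¬flat o s-ascent (subst (Flat o) (next-prev s) flat-next)

    weight-injective : ∀ u v → weight u ≡ weight v → u ≡ v
    weight-injective u v e with classify u | classify v
    ... | inj₁ refl        | _                = sym (weight≡0⇒t (trans (sym e) weight-t))
    ... | inj₂ (inj₁ refl) | _                = sym (large-weight⇒s (subst (3 + k <_) e weight-s))
    ... | _                | inj₁ refl        = weight≡0⇒t (trans e weight-t)
    ... | _                | inj₂ (inj₁ refl) = large-weight⇒s (subst (3 + k <_) (sym e) weight-s)
    ... | inj₂ (inj₂ fu)   | inj₂ (inj₂ fv)   =
      flat-weight-injective o f (proj₁ f-bijective) unflanked fu fv e

    antimagic : IsAntimagic1 o
    antimagic = f , f-bijective , weight-injective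

  theta⇒antimagic : ThetaOriented o → IsAntimagic1 o
  theta⇒antimagic (s , t , s-source , source-unique , t-sink , sink-unique , adjacent) =
    ThetaLabeling.antimagic (to (source⇔ascent o) s-source) (to (sink⇔descent o) t-sink)
                            (t-next-to-s adjacent) classify
    where
    t-next-to-s : Arc o s t ⊎ Arc o t s → t ≡ next s ⊎ t ≡ prev s
    t-next-to-s (inj₂ t→s) = contradiction t→s (t-sink s)
    t-next-to-s (inj₁ s→t) with arcView o {s} {t} s→t
    ... | forward _  = inj₁ refl
    ... | backward _ = inj₂ refl
    classify : ∀ v → v ≡ t ⊎ v ≡ s ⊎ Flat o v
    classify v with descent⊎ascent⊎flat o v
    ... | inj₁ descent       = inj₁ (sink-unique v (from (sink⇔descent o) descent))
    ... | inj₂ (inj₁ ascent) = inj₂ (inj₁ (source-unique v (from (source⇔ascent o) ascent)))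
    ... | inj₂ (inj₂ flat)   = inj₂ (inj₂ flat)

  module _ {f : Fin (3 + k) → Fin (3 + k)}
           (weight-injective : ∀ u v → weight1 o f u ≡ weight1 o f v → u ≡ v) where

    descent⇒adjacent-ascent : ∀ {t} → Descent o t → ∃ λ s → Ascent o s × Arc o s t
    descent⇒adjacent-ascent {t} (pt , ot) with o (prev (prev t)) in p | o (next t) in q
    ... | false | _     =
      prev t , (p , pt) , subst (Arc o (prev t)) (next-prev t) (arc-forward o {prev t} pt)
    ... | true  | true  =
      next t , (o-prev-next , q) , subst (Arc o (next t)) (prev-next t) (arc-backward o {next t} o-prev-next)
      where
      o-prev-next : o (prev (next t)) ≡ false
      o-prev-next = trans (cong o (prev-next t)) ot
    ... | true  | false = contradiction (sym (weight-injective (prev t) (next t) same-weight)) (next≢prev t)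
      where
      out-prev : outNeighbour o (prev t) ≡ t
      out-prev = trans (cong (λ b → if b then next (prev t) else prev (prev t)) pt) (next-prev t)
      out-next : outNeighbour o (next t) ≡ t
      out-next = trans (cong (λ b → if b then next (next t) else prev (next t)) q) (prev-next t)
      same-weight : weight1 o f (prev t) ≡ weight1 o f (next t)
      same-weight = begin
        weight1 o f (prev t)               ≡⟨ weight-flat o f (trans p (sym pt)) ⟩
        label f (outNeighbour o (prev t))  ≡⟨ cong (label f) (trans out-prev (sym out-next)) ⟩
        label f (outNeighbour o (next t))  ≡⟨ weight-flat o f (trans (cong o (prev-next t)) (trans ot (sym q))) ⟨
        weight1 o f (next t)               ∎
        where open ≡-Reasoning

    descent⇒theta : ∀ {t} → Descent o t → ThetaOriented o
    descent⇒theta {t} t-descent with descent⇒adjacent-ascent t-descent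
    ... | s , s-ascent , s→t =
      s , t , from (source⇔ascent o) s-ascent , source-unique ,
      from (sink⇔descent o) t-descent , sink-unique , inj₁ s→t
      where
      descent-unique : ∀ {y} → Descent o y → y ≡ t
      descent-unique d =
        weight-injective _ t (trans (weight-descent o f d) (sym (weight-descent o f t-descent)))
      one-ascent : count (ascent? o) ≡ 1
      one-ascent = trans (sym (descents≡ascents o)) (count≡1 (descent? o) t-descent (λ _ → descent-unique))
      source-unique : ∀ s′ → IsSource o s′ → s′ ≡ s
      source-unique s′ source =
        count≡1⇒unique (ascent? o) one-ascent (to (source⇔ascent o) source) s-ascent
      sink-unique : ∀ t′ → IsSink o t′ → t′ ≡ t
      sink-unique t′ sink = descent-unique (to (sink⇔descent o) sink)

  antimagic⇒unidirectional⊎theta : IsAntimagic1 o → Unidirectional o ⊎ ThetaOriented o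
  antimagic⇒unidirectional⊎theta (f , _ , weight-injective) with any? (descent? o)
  ... | yes (t , t-descent) = inj₂ (descent⇒theta weight-injective t-descent)
  ... | no ∄descent         = inj₁ (flat⇒unidirectional (no-descent⇒flat o λ v d → ∄descent (v , d)))

mainTheorem1 : (n : ℕ) → 3 ≤ n → (o : Orientation n) →
    IsAntimagic1 o ⇔ (Unidirectional o ⊎ ThetaOriented o)
mainTheorem1 (suc (suc (suc k))) (s≤s (s≤s (s≤s _))) o =
  mk⇔ antimagic⇒unidirectional⊎theta [ unidirectional⇒antimagic , theta⇒antimagic ]′
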